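{- Let $G=H\oplus_3K$ be a $3$-sum of $2$-connected cubic graphs $H$ and $K$ such that $\pi(G)=4$. If $\pi(H)\ge5$ or $\pi(K)\ge5$, then for every perfect-matching $4$-cover of $G$ each edge of the principal $3$-edge-cut is doubly covered.
   Context: Graphs are finite; multiple edges and loops permitted. $\pi(G)$ is the minimum number of perfect matchings of $G$ whose union is $E(G)$. A perfect-matching $4$-cover of $G$ is a set of four perfect matchings whose union is $E(G)$; an edge is doubly covered if it belongs to exactly two of them. $3$-sum $H\oplus_3K$: with distinguished vertices $u\in V(H)$, $v\in V(K)$, delete $u,v$ and join the three edge-ends formerly at $u$ bijectively to the three edge-ends formerly at $v$; the three new edges form the principal $3$-edge-cut. -}

module Defs where

open import Data.Nat using (ℕ; zero; suc; _+_; _<_; _≤_)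
open import Data.Fin using (Fin; zero; suc)
open import Data.Fin.Properties using (_≟_)
open import Data.Bool using (Bool; true; false; not; if_then_else_; T)
open import Data.Product using (Σ; ∃; _×_; _,_; proj₁; proj₂)
open import Data.Sum using (_⊎_; inj₁; inj₂)
open import Data.Unit using (⊤)
open import Relation.Nullary using (¬_; does)
open import Relation.Binary.PropositionalEquality using (_≡_; _≢_)

sumF : ∀ {k} → (Fin k → ℕ) → ℕ
sumF {zero}  f = 0
sumF {suc k} f = f zero + sumF (λ i → f (suc i))

countF : ∀ {k} → (Fin k → Bool) → ℕ
countF p = sumF (λ i → if p i then 1 else 0)

-- Finite multigraphs (multiple edges and loops allowed).

record Graph : Set where
  field
    n   : ℕ
    m   : ℕ
    end : Fin m → Bool → Fin n
open Graph public

δ : ∀ {n} → Fin n → Fin n → ℕ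
δ x y = if does (x ≟ y) then 1 else 0

-- number of edge-ends of edges in S lying at v (a loop contributes 2)
degIn : (G : Graph) → (Fin (m G) → Bool) → Fin (n G) → ℕ
degIn G S v = sumF (λ e → if S e then δ (end G e true) v + δ (end G e false) v else 0)

degree : (G : Graph) → Fin (n G) → ℕ
degree G = degIn G (λ _ → true)

Cubic : Graph → Set
Cubic G = ∀ v → degree G v ≡ 3

Loopless : Graph → Set
Loopless G = ∀ e → end G e true ≢ end G e false

incidentᵇ : (G : Graph) → Fin (m G) → Fin (n G) → Bool
incidentᵇ G e v = does (end G e true ≟ v) Data.Bool.∨ does (end G e false ≟ v)

data Reach (G : Graph) (P : Fin (n G) → Set) : Fin (n G) → Fin (n G) → Set where
  here : ∀ {a} → Reach G P a a
  step : ∀ {b} (e : Fin (m G)) (s : Bool) →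
         P (end G e s) → P (end G e (not s)) →
         Reach G P (end G e (not s)) b → Reach G P (end G e s) b

Connected : Graph → Set
Connected G = ∀ a b → Reach G (λ _ → ⊤) a b

ConnectedWithout : (G : Graph) → Fin (n G) → Set
ConnectedWithout G x = ∀ a b → a ≢ x → b ≢ x → Reach G (λ y → y ≢ x) a b

TwoConnected : Graph → Set
TwoConnected G = (2 ≤ n G) × Loopless G × Connected G × (∀ x → ConnectedWithout G x)

-- a set M of edges is a perfect matching iff every vertex is incident
-- with exactly one edge-end of M (in particular M contains no loop)
IsPerfectMatching : (G : Graph) → (Fin (m G) → Bool) → Set
IsPerfectMatching G M = ∀ v → degIn G M v ≡ 1

IsPMCover : (G : Graph) (k : ℕ) → (Fin k → Fin (m G) → Bool) → Set
IsPMCover G k M = (∀ i → IsPerfectMatching G (M i)) × (∀ e → ∃ λ i → M i e ≡ true)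

HasPMCover : Graph → ℕ → Set
HasPMCover G k = Σ (Fin k → Fin (m G) → Bool) (IsPMCover G k)

-- π(G) ≥ k   (π(G) = ∞ if no cover exists, which also counts as ≥ k)
PiAtLeast : Graph → ℕ → Set
PiAtLeast G k = ∀ j → j < k → ¬ HasPMCover G j

PiEq : Graph → ℕ → Set
PiEq G k = HasPMCover G k × PiAtLeast G k

coverCount : (G : Graph) {k : ℕ} → (Fin k → Fin (m G) → Bool) → Fin (m G) → ℕ
coverCount G M e = countF (λ i → M i e)

DoublyCovered : (G : Graph) {k : ℕ} → (Fin k → Fin (m G) → Bool) → Fin (m G) → Set
DoublyCovered G M e = coverCount G M e ≡ 2

Bijection : {A B : Set} → (A → B) → Set
Bijection f = (∀ a b → f a ≡ f b → a ≡ b) × (∀ y → ∃ λ x → f x ≡ y)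

SameEnds : {V : Set} → (Bool → V) → (Bool → V) → Set
SameEnds f g = (∀ s → f s ≡ g s) ⊎ (∀ s → f s ≡ g (not s))

VMinus : (G : Graph) → Fin (n G) → Set
VMinus G u = Σ (Fin (n G)) λ x → T (not (does (x ≟ u)))

EMinus : (G : Graph) → Fin (n G) → Set
EMinus G u = Σ (Fin (m G)) λ e → T (not (incidentᵇ G e u))

otherEnd : (G : Graph) → Fin (m G) × Bool → Fin (n G)
otherEnd G (e , s) = end G e (not s)

record EndsAt (G : Graph) (u : Fin (n G)) : Set where
  field
    dart   : Fin 3 → Fin (m G) × Bool
    atU    : ∀ i → end G (proj₁ (dart i)) (proj₂ (dart i)) ≡ u
    inj    : ∀ i j → dart i ≡ dart j → i ≡ j
    allAtU : ∀ e s → end G e s ≡ u → ∃ λ i → dart i ≡ (e , s)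

vmap : (H : Graph) (u : Fin (n H)) (K : Graph) (v : Fin (n K)) {V : Set} →
       (Fin (n H) → V) → (Fin (n K) → V) → VMinus H u ⊎ VMinus K v → V
vmap H u K v αH αK (inj₁ (x , _)) = αH x
vmap H u K v αH αK (inj₂ (y , _)) = αK y

emap : (H : Graph) (u : Fin (n H)) (K : Graph) (v : Fin (n K)) {E : Set} →
       (Fin 3 → E) → (Fin (m H) → E) → (Fin (m K) → E) →
       EMinus H u ⊎ (EMinus K v ⊎ Fin 3) → E
emap H u K v cut βH βK (inj₁ (e , _)) = βH e
emap H u K v cut βH βK (inj₂ (inj₁ (f , _))) = βK f
emap H u K v cut βH βK (inj₂ (inj₂ i)) = cut i

-- G ≅ H ⊕₃ K with distinguished vertices u ∈ V(H), v ∈ V(K);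
-- cut i (i : Fin 3) are the three new edges (the principal 3-edge-cut).
-- The edge-end dH i formerly at u is joined to the edge-end dK i formerly
-- at v (every bijection between the ends arises from some enumeration).
record IsThreeSum (G H : Graph) (u : Fin (n H)) (K : Graph) (v : Fin (n K))
                  (cut : Fin 3 → Fin (m G)) : Set where
  field
    αH : Fin (n H) → Fin (n G)
    αK : Fin (n K) → Fin (n G)
    βH : Fin (m H) → Fin (m G)
    βK : Fin (m K) → Fin (m G)
    dH : EndsAt H u
    dK : EndsAt K v
    vbij  : Bijection (vmap H u K v αH αK)
    ebij  : Bijection (emap H u K v cut βH βK)
    endsH : ∀ e → T (not (incidentᵇ H e u)) →
            SameEnds (end G (βH e)) (λ s → αH (end H e s))
    endsK : ∀ f → T (not (incidentᵇ K f v)) →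
            SameEnds (end G (βK f)) (λ s → αK (end K f s))
    endsCut : ∀ i → SameEnds (end G (cut i))
                (λ s → if s then αH (otherEnd H (EndsAt.dart dH i))
                            else αK (otherEnd K (EndsAt.dart dK i)))

-- Restricting a perfect-matching 4-cover of G to the H side, with the edges of H at u standing in for
-- the cut edges, gives four edge sets of H that cover E(H) and are perfect matchings at every vertex
-- other than u. At such a vertex the cover multiplicities of its three edges sum to 4, so exactly one
-- of them is doubly covered. The doubly covered edges therefore have degree 1 away from u, and parity
-- in the cubic graph H makes their degree at u equal to 1 or 3. Degree 1 forces the four sets to be
-- perfect matchings of H, contradicting π(H) ≥ 5; degree 3 says all cut edges are doubly covered.
-- The case π(K) ≥ 5 is the same argument applied to the 3-sum read from the K side.
module Submission where

open import Defs
open import Data.Fin using (Fin)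
open import Data.Sum using (_⊎_)
open import Data.Bool using (Bool)

open import Algebra.Properties.CommutativeSemigroup using (interchange)
open import Data.Bool using (true; false; not; if_then_else_; T)
open import Data.Empty using (⊥-elim)
open import Data.Fin using (zero; suc)
open import Data.Fin.Properties using (_≟_; suc-injective)
open import Data.Nat using (ℕ; zero; suc; _+_; _*_; _∸_; _≤_; z≤n; s≤s; _≡ᵇ_; >-nonZero)
open import Data.Nat.Properties as ℕ
  using (*-zeroʳ; *-identityʳ; *-suc; +-identityʳ; +-comm; +-cancelˡ-≡; +-cancelʳ-≤;
         +-mono-≤; *-distribˡ-+; ≤-refl; ≤-reflexive; ≤-trans; ≤-antisym;
         m≤m+n; m≤n+m; m≤n+m∸n; m≤n*m; m+n≡0⇒m≡0; m+n≡0⇒n≡0; 0≢1+n; >⇒≢; even≢odd; ≡ᵇ⇒≡;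
         +-commutativeSemigroup; module ≤-Reasoning)
open import Data.Nat.Tactic.RingSolver using (solve-∀)
open import Data.Product using (Σ; ∃; _×_; _,_; proj₁; proj₂)
open import Data.Sum using (inj₁; inj₂; swap; [_,_]′)
open import Data.Sum.Properties using (swap-involutive; inj₁-injective; inj₂-injective)
open import Data.Bool.Properties using (not-involutive)
open import Function using (_∘_)
open import Relation.Nullary using (¬_; yes; no; does)
open import Relation.Binary.PropositionalEquality
  using (_≡_; _≢_; refl; sym; trans; cong; cong₂; subst; module ≡-Reasoning)

sumF-cong : ∀ {k} {f g : Fin k → ℕ} → (∀ i → f i ≡ g i) → sumF f ≡ sumF g
sumF-cong {zero}  f≗g = refl
sumF-cong {suc k} f≗g = cong₂ _+_ (f≗g zero) (sumF-cong (f≗g ∘ suc))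

sumF-const : ∀ {k} c → sumF {k} (λ _ → c) ≡ k * c
sumF-const {zero}  c = refl
sumF-const {suc k} c = cong (c +_) (sumF-const {k} c)

sumF-zero : ∀ k → sumF {k} (λ _ → 0) ≡ 0
sumF-zero k = trans (sumF-const {k} 0) (*-zeroʳ k)

sumF-one : ∀ k → sumF {k} (λ _ → 1) ≡ k
sumF-one k = trans (sumF-const {k} 1) (*-identityʳ k)

sumF-distrib-+ : ∀ {k} (f g : Fin k → ℕ) → sumF (λ i → f i + g i) ≡ sumF f + sumF g
sumF-distrib-+ {zero}  f g = refl
sumF-distrib-+ {suc k} f g =
  trans (cong (f zero + g zero +_) (sumF-distrib-+ (f ∘ suc) (g ∘ suc)))
        (interchange +-commutativeSemigroup (f zero) (g zero) (sumF (f ∘ suc)) (sumF (g ∘ suc)))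

sumF-*ˡ : ∀ {k} c (f : Fin k → ℕ) → sumF (λ i → c * f i) ≡ c * sumF f
sumF-*ˡ {zero}  c f = sym (*-zeroʳ c)
sumF-*ˡ {suc k} c f = trans (cong (c * f zero +_) (sumF-*ˡ c (f ∘ suc))) (sym (*-distribˡ-+ c (f zero) _))

sumF-comm : ∀ {k l} (f : Fin k → Fin l → ℕ) →
            sumF (λ i → sumF (λ j → f i j)) ≡ sumF (λ j → sumF (λ i → f i j))
sumF-comm {zero}  {l} f = sym (sumF-zero l)
sumF-comm {suc k}     f = trans (cong (sumF (f zero) +_) (sumF-comm (f ∘ suc)))
                                (sym (sumF-distrib-+ (f zero) (λ j → sumF (λ i → f (suc i) j))))

sumF-mono-≤ : ∀ {k} {f g : Fin k → ℕ} → (∀ i → f i ≤ g i) → sumF f ≤ sumF g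
sumF-mono-≤ {zero}  f≤g = z≤n
sumF-mono-≤ {suc k} f≤g = +-mono-≤ (f≤g zero) (sumF-mono-≤ (f≤g ∘ suc))

sumF-mono-≤-≡ : ∀ {k} {f g : Fin k → ℕ} → (∀ i → f i ≤ g i) → sumF f ≡ sumF g → ∀ i → f i ≡ g i
sumF-mono-≤-≡ {suc k} {f} {g} f≤g Σf≡Σg = λ
  { zero    → f₀≡g₀
  ; (suc i) → sumF-mono-≤-≡ (f≤g ∘ suc) (+-cancelˡ-≡ (f zero) _ _ (trans Σf≡Σg (cong (_+ _) (sym f₀≡g₀)))) i
  }
  where
  open ≤-Reasoning
  f₀≡g₀ : f zero ≡ g zero
  f₀≡g₀ = ≤-antisym (f≤g zero) (+-cancelʳ-≤ (sumF (g ∘ suc)) (g zero) (f zero) (begin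
    g zero + sumF (g ∘ suc) ≡⟨ sym Σf≡Σg ⟩
    f zero + sumF (f ∘ suc) ≤⟨ +-mono-≤ ≤-refl (sumF-mono-≤ (f≤g ∘ suc)) ⟩
    f zero + sumF (g ∘ suc) ∎))

f≤sumF : ∀ {k} (f : Fin k → ℕ) i → f i ≤ sumF f
f≤sumF f zero    = m≤m+n (f zero) _
f≤sumF f (suc i) = ≤-trans (f≤sumF (f ∘ suc) i) (m≤n+m _ (f zero))

sumF≡0⇒ : ∀ {k} (f : Fin k → ℕ) → sumF f ≡ 0 → ∀ i → f i ≡ 0
sumF≡0⇒ f Σf≡0 zero    = m+n≡0⇒m≡0 (f zero) Σf≡0
sumF≡0⇒ f Σf≡0 (suc i) = sumF≡0⇒ (f ∘ suc) (m+n≡0⇒n≡0 (f zero) Σf≡0) i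

sumF≡1⇒ : ∀ {k} (f : Fin k → ℕ) → sumF f ≡ 1 → ∃ λ i → f i ≡ 1 × (∀ j → j ≢ i → f j ≡ 0)
sumF≡1⇒ {suc k} f Σf≡1 with f zero in f₀
... | 0 =
  let i , fi≡1 , rest = sumF≡1⇒ (f ∘ suc) Σf≡1
  in suc i , fi≡1 , λ { zero _ → f₀ ; (suc j) j≢i → rest j (j≢i ∘ cong suc) }
... | 1 = zero , f₀ , λ { zero j≢0 → ⊥-elim (j≢0 refl) ; (suc j) _ → sumF≡0⇒ (f ∘ suc) (ℕ.suc-injective Σf≡1) j }

sumF-single : ∀ {k} (f : Fin k → ℕ) i → (∀ j → j ≢ i → f j ≡ 0) → sumF f ≡ f i
sumF-single {suc k} f zero    rest = trans (cong (f zero +_) (trans (sumF-cong (λ j → rest (suc j) λ ())) (sumF-zero k)))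
                                           (+-identityʳ (f zero))
sumF-single {suc k} f (suc i) rest = trans (cong (_+ sumF (f ∘ suc)) (rest zero λ ()))
                                           (sumF-single (f ∘ suc) i (λ j j≢i → rest (suc j) (j≢i ∘ suc-injective)))

sumF-allBut : ∀ {k} (f : Fin k → ℕ) i → (∀ j → j ≢ i → f j ≡ 1) → 1 + sumF f ≡ k + f i
sumF-allBut {suc k} f zero    rest =
  cong suc (trans (cong (f zero +_) (trans (sumF-cong (λ j → rest (suc j) λ ())) (sumF-one k))) (+-comm (f zero) k))
sumF-allBut {suc k} f (suc i) rest = trans (cong (λ t → 1 + (t + sumF (f ∘ suc))) (rest zero λ ()))
  (cong suc (sumF-allBut (f ∘ suc) i (λ j j≢i → rest (suc j) (j≢i ∘ suc-injective))))

δ-refl : ∀ {k} (x : Fin k) → δ x x ≡ 1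
δ-refl x with x ≟ x
... | yes _   = refl
... | no x≢x = ⊥-elim (x≢x refl)

δ-≢ : ∀ {k} {x y : Fin k} → x ≢ y → δ x y ≡ 0
δ-≢ {x = x} {y} x≢y with x ≟ y
... | yes x≡y = ⊥-elim (x≢y x≡y)
... | no _    = refl

1≤δ⇒≡ : ∀ {k} (x y : Fin k) → 1 ≤ δ x y → x ≡ y
1≤δ⇒≡ x y 1≤δ with x ≟ y
... | yes x≡y = x≡y
1≤δ⇒≡ x y () | no _

sumF-δ : ∀ {k} (x : Fin k) → sumF (δ x) ≡ 1
sumF-δ x = trans (sumF-single (δ x) x (λ y y≢x → δ-≢ (y≢x ∘ sym))) (δ-refl x)

incidence : (Γ : Graph) → Fin (n Γ) → Fin (m Γ) → ℕ
incidence Γ w e = δ (end Γ e true) w + δ (end Γ e false) w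

HasEnd : (Γ : Graph) → Fin (m Γ) → Fin (n Γ) → Set
HasEnd Γ e w = ∃ λ s → end Γ e s ≡ w

HasEnd⇒1≤incidence : (Γ : Graph) {e : Fin (m Γ)} {w : Fin (n Γ)} → HasEnd Γ e w → 1 ≤ incidence Γ w e
HasEnd⇒1≤incidence Γ {e} (true  , refl) = ≤-trans (≤-reflexive (sym (δ-refl (end Γ e true)))) (m≤m+n _ _)
HasEnd⇒1≤incidence Γ {e} (false , refl) = ≤-trans (≤-reflexive (sym (δ-refl (end Γ e false)))) (m≤n+m _ _)

1≤incidence⇒HasEnd : (Γ : Graph) {e : Fin (m Γ)} {w : Fin (n Γ)} → 1 ≤ incidence Γ w e → HasEnd Γ e w
1≤incidence⇒HasEnd Γ {e} {w} 1≤inc with end Γ e true ≟ w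
... | yes p = true , p
... | no _  = false , 1≤δ⇒≡ (end Γ e false) w 1≤inc

¬HasEnd⇒incidence≡0 : (Γ : Graph) {e : Fin (m Γ)} {w : Fin (n Γ)} → ¬ HasEnd Γ e w → incidence Γ w e ≡ 0
¬HasEnd⇒incidence≡0 Γ ¬end = cong₂ _+_ (δ-≢ (λ p → ¬end (true , p))) (δ-≢ (λ p → ¬end (false , p)))

otherEnd≢ : (Γ : Graph) → Loopless Γ → ∀ {e w} s → end Γ e s ≡ w → end Γ e (not s) ≢ w
otherEnd≢ Γ loopless {e} true  p q = loopless e (trans p (sym q))
otherEnd≢ Γ loopless {e} false p q = loopless e (trans q (sym p))

loopless⇒incidence≤1 : (Γ : Graph) → Loopless Γ → ∀ w e → incidence Γ w e ≤ 1
loopless⇒incidence≤1 Γ loopless w e with end Γ e true ≟ w | end Γ e false ≟ w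
... | yes p | yes q = ⊥-elim (otherEnd≢ Γ loopless {e} true p q)
... | yes _ | no _  = ≤-refl
... | no _  | yes _ = ≤-refl
... | no _  | no _  = z≤n

if-then-0≤ : ∀ b a → (if b then a else 0) ≤ a
if-then-0≤ true  a = ≤-refl
if-then-0≤ false a = z≤n

if-then-0≡* : ∀ b a → (if b then a else 0) ≡ a * (if b then 1 else 0)
if-then-0≡* true  a = sym (*-identityʳ a)
if-then-0≡* false a = sym (*-zeroʳ a)

degIn≤degree : (Γ : Graph) (S : Fin (m Γ) → Bool) (w : Fin (n Γ)) → degIn Γ S w ≤ degree Γ w
degIn≤degree Γ S w = sumF-mono-≤ (λ e → if-then-0≤ (S e) (incidence Γ w e))

degIn≡degree⇒∈ : (Γ : Graph) (S : Fin (m Γ) → Bool) {w : Fin (n Γ)} →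
  degIn Γ S w ≡ degree Γ w → ∀ {e} → HasEnd Γ e w → T (S e)
degIn≡degree⇒∈ Γ S {w} deg≡degree {e} end
  with S e | sumF-mono-≤-≡ (λ e → if-then-0≤ (S e) (incidence Γ w e)) deg≡degree e
... | true  | _      = _
... | false | 0≡inc = ⊥-elim (>⇒≢ (HasEnd⇒1≤incidence Γ end) (sym 0≡inc))

EdgeAt : (Γ : Graph) → (Fin (m Γ) → Bool) → Fin (n Γ) → Fin (m Γ) → Set
EdgeAt Γ S w e = S e ≡ true × HasEnd Γ e w

module _ (Γ : Graph) (S : Fin (m Γ) → Bool) (w : Fin (n Γ)) where

  private
    term : Fin (m Γ) → ℕ
    term e = if S e then incidence Γ w e else 0

    EdgeAt⇒1≤term : ∀ {e} → EdgeAt Γ S w e → 1 ≤ term e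
    EdgeAt⇒1≤term (Se , end) rewrite Se = HasEnd⇒1≤incidence Γ end

    term≡1⇒EdgeAt : ∀ e → term e ≡ 1 → EdgeAt Γ S w e
    term≡1⇒EdgeAt e term≡1 with S e
    ... | true  = refl , 1≤incidence⇒HasEnd Γ (≤-reflexive (sym term≡1))
    ... | false = ⊥-elim (0≢1+n term≡1)

  degIn≡1⇒unique : degIn Γ S w ≡ 1 → ∃ λ e → EdgeAt Γ S w e × (∀ e′ → EdgeAt Γ S w e′ → e′ ≡ e)
  degIn≡1⇒unique deg≡1 with sumF≡1⇒ term deg≡1
  ... | e , term≡1 , others≡0 = e , term≡1⇒EdgeAt e term≡1 , unique
    where
    unique : ∀ e′ → EdgeAt Γ S w e′ → e′ ≡ e
    unique e′ at with e′ ≟ e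
    ... | yes e′≡e = e′≡e
    ... | no  e′≢e = ⊥-elim (>⇒≢ (EdgeAt⇒1≤term at) (others≡0 e′ e′≢e))

  unique⇒degIn≡1 : Loopless Γ → ∀ {e} → EdgeAt Γ S w e → (∀ e′ → EdgeAt Γ S w e′ → e′ ≡ e) → degIn Γ S w ≡ 1
  unique⇒degIn≡1 loopless {e} (Se , end) unique = trans (sumF-single term e others≡0) term≡1
    where
    term≡1 : term e ≡ 1
    term≡1 rewrite Se = ≤-antisym (loopless⇒incidence≤1 Γ loopless w e) (HasEnd⇒1≤incidence Γ end)
    others≡0 : ∀ j → j ≢ e → term j ≡ 0
    others≡0 j j≢e with S j in Sj
    ... | true  = ¬HasEnd⇒incidence≡0 Γ (λ end′ → j≢e (unique j (Sj , end′)))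
    ... | false = refl

degIn≡1-pullback : (Γ G : Graph) → Loopless Γ →
  (ψ : Fin (m Γ) → Fin (m G)) → (∀ {e e′} → ψ e ≡ ψ e′ → e ≡ e′) →
  {x : Fin (n Γ)} {y : Fin (n G)} →
  (∀ {e} → HasEnd Γ e x → HasEnd G (ψ e) y) →
  (∀ {g} → HasEnd G g y → ∃ λ e → ψ e ≡ g × HasEnd Γ e x) →
  (S : Fin (m G) → Bool) → degIn G S y ≡ 1 → degIn Γ (S ∘ ψ) x ≡ 1
degIn≡1-pullback Γ G loopless ψ ψ-injective lift lower S deg≡1 with degIn≡1⇒unique G S _ deg≡1
... | g , (Sg , end) , unique with lower end
... | e , refl , endΓ = unique⇒degIn≡1 Γ (S ∘ ψ) _ loopless (Sg , endΓ)
                          (λ e′ (Se′ , end′) → ψ-injective (unique (ψ e′) (Se′ , lift end′)))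

handshake : (Γ : Graph) (S : Fin (m Γ) → Bool) → sumF (degIn Γ S) ≡ 2 * countF S
handshake Γ S = begin
  sumF (degIn Γ S)                                              ≡⟨ sumF-comm (λ w e → if S e then incidence Γ w e else 0) ⟩
  sumF (λ e → sumF (λ w → if S e then incidence Γ w e else 0)) ≡⟨ sumF-cong twoEnds ⟩
  sumF (λ e → 2 * (if S e then 1 else 0))                       ≡⟨ sumF-*ˡ 2 (λ e → if S e then 1 else 0) ⟩
  2 * countF S                                                  ∎
  where
  open ≡-Reasoning
  twoEnds : ∀ e → sumF (λ w → if S e then incidence Γ w e else 0) ≡ 2 * (if S e then 1 else 0)
  twoEnds e with S e
  ... | true  = trans (sumF-distrib-+ (δ (end Γ e true)) (δ (end Γ e false))) (cong₂ _+_ (sumF-δ (end Γ e true)) (sumF-δ (end Γ e false)))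
  ... | false = sumF-zero (n Γ)

even⊎odd : ∀ n → ∃ λ q → n ≡ 2 * q ⊎ n ≡ suc (2 * q)
even⊎odd zero    = 0 , inj₁ refl
even⊎odd (suc n) with even⊎odd n
... | q , inj₁ refl = q , inj₂ refl
... | q , inj₂ refl = suc q , inj₁ (sym (*-suc 2 q))

-- The order n is even since 3n = 2|E|, so n + d, being odd, forces d odd.
parity-1⊎3 : ∀ {n d c e} → n * 3 ≡ 2 * e → suc (2 * c) ≡ n + d → d ≤ 3 → d ≡ 1 ⊎ d ≡ 3
parity-1⊎3 {n} {d} {c} {e} 3n≡2e odd≡n+d d≤3 with even⊎odd n
... | q , inj₂ refl = ⊥-elim (even≢odd e (3 * q + 1) (trans (sym 3n≡2e) (solve q)))
  where
  solve : ∀ q → (1 + 2 * q) * 3 ≡ 1 + 2 * (3 * q + 1)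
  solve = solve-∀
... | q , inj₁ refl with d | d≤3
... | 0 | _ = ⊥-elim (even≢odd q c (sym (trans odd≡n+d (+-identityʳ (2 * q)))))
... | 1 | _ = inj₁ refl
... | 2 | _ = ⊥-elim (even≢odd (suc q) c (trans (*-suc 2 q) (trans (+-comm 2 (2 * q)) (sym odd≡n+d))))
... | 3 | _ = inj₂ refl
... | suc (suc (suc (suc _))) | s≤s (s≤s (s≤s ()))

IsPerfectOff : (Γ : Graph) → Fin (n Γ) → (Fin (m Γ) → Bool) → Set
IsPerfectOff Γ u S = ∀ x → x ≢ u → degIn Γ S x ≡ 1

perfectOff⇒degIn≡1⊎3 : (Γ : Graph) → Cubic Γ → ∀ {u S} → IsPerfectOff Γ u S → degIn Γ S u ≡ 1 ⊎ degIn Γ S u ≡ 3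
perfectOff⇒degIn≡1⊎3 Γ cubic {u} {S} perfectOff =
  parity-1⊎3 {n Γ} {c = countF S} {e = m Γ} 3n≡2m
    (trans (cong suc (sym (handshake Γ S))) (sumF-allBut (degIn Γ S) u perfectOff))
    (≤-trans (degIn≤degree Γ S u) (≤-reflexive (cubic u)))
  where
  3n≡2m : n Γ * 3 ≡ 2 * m Γ
  3n≡2m = begin
    n Γ * 3                    ≡⟨ sumF-const {n Γ} 3 ⟨
    sumF {n Γ} (λ _ → 3)       ≡⟨ sumF-cong (sym ∘ cubic) ⟩
    sumF (degree Γ)            ≡⟨ handshake Γ (λ _ → true) ⟩
    2 * countF {m Γ} (λ _ → true) ≡⟨ cong (2 *_) (sumF-one (m Γ)) ⟩
    2 * m Γ                    ∎
    where open ≡-Reasoning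

double-counting : (Γ : Graph) {k : ℕ} (N : Fin k → Fin (m Γ) → Bool) (w : Fin (n Γ)) →
  sumF (λ j → degIn Γ (N j) w) ≡ sumF (λ e → incidence Γ w e * coverCount Γ N e)
double-counting Γ N w =
  trans (sumF-comm (λ j e → if N j e then incidence Γ w e else 0))
        (sumF-cong λ e → trans (sumF-cong λ j → if-then-0≡* (N j e) (incidence Γ w e))
                               (sumF-*ˡ (incidence Γ w e) (λ j → if N j e then 1 else 0)))

covered⇒1≤coverCount : (Γ : Graph) {k : ℕ} (N : Fin k → Fin (m Γ) → Bool) {e : Fin (m Γ)} →
  (∃ λ j → N j e ≡ true) → 1 ≤ coverCount Γ N e
covered⇒1≤coverCount Γ N {e} (j , Nje) =
  ≤-trans (≤-reflexive (sym (cong (λ b → if b then 1 else 0) Nje))) (f≤sumF (λ j → if N j e then 1 else 0) j)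

1≤n⇒m*n≡m+m*[n∸1] : ∀ m {n} → 1 ≤ n → m * n ≡ m + m * (n ∸ 1)
1≤n⇒m*n≡m+m*[n∸1] m {suc n} _ = *-suc m n

if-≡ᵇ2 : ∀ {c} → 1 ≤ c → c ≤ 2 → ∀ a → (if c ≡ᵇ 2 then a else 0) ≡ a * (c ∸ 1)
if-≡ᵇ2 {1} _ _ a = sym (*-zeroʳ a)
if-≡ᵇ2 {2} _ _ a = sym (*-identityʳ a)
if-≡ᵇ2 {suc (suc (suc _))} _ (s≤s (s≤s ())) a

1⊎3⇒1≤ : ∀ {d} → d ≡ 1 ⊎ d ≡ 3 → 1 ≤ d
1⊎3⇒1≤ (inj₁ refl) = s≤s z≤n
1⊎3⇒1≤ (inj₂ refl) = s≤s z≤n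

module _ (Γ : Graph) (cubic : Cubic Γ) (loopless : Loopless Γ) {u : Fin (n Γ)} {N : Fin 4 → Fin (m Γ) → Bool}
         (perfectOff : ∀ j → IsPerfectOff Γ u (N j)) (covers : ∀ e → ∃ λ j → N j e ≡ true) where

  private
    excess : Fin (n Γ) → ℕ
    excess w = sumF (λ e → incidence Γ w e * (coverCount Γ N e ∸ 1))

    double-counting-excess : ∀ w → sumF (λ j → degIn Γ (N j) w) ≡ 3 + excess w
    double-counting-excess w = begin
      sumF (λ j → degIn Γ (N j) w)                                            ≡⟨ double-counting Γ N w ⟩
      sumF (λ e → incidence Γ w e * coverCount Γ N e)                         ≡⟨ sumF-cong split ⟩
      sumF (λ e → incidence Γ w e + incidence Γ w e * (coverCount Γ N e ∸ 1)) ≡⟨ sumF-distrib-+ (incidence Γ w) _ ⟩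
      degree Γ w + excess w                                                   ≡⟨ cong (_+ excess w) (cubic w) ⟩
      3 + excess w                                                            ∎
      where
      open ≡-Reasoning
      split : ∀ e → incidence Γ w e * coverCount Γ N e ≡ incidence Γ w e + incidence Γ w e * (coverCount Γ N e ∸ 1)
      split e = 1≤n⇒m*n≡m+m*[n∸1] (incidence Γ w e) (covered⇒1≤coverCount Γ N (covers e))

    excess-off : ∀ x → x ≢ u → excess x ≡ 1
    excess-off x x≢u = +-cancelˡ-≡ 3 _ _ (trans (sym (double-counting-excess x)) (sumF-cong (λ j → perfectOff j x x≢u)))

    end-off : ∀ e → ∃ λ s → end Γ e s ≢ u
    end-off e with end Γ e true ≟ u
    ... | yes p   = false , otherEnd≢ Γ loopless true p
    ... | no  e≢u = true , e≢u

    coverCount≤2 : ∀ e → coverCount Γ N e ≤ 2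
    coverCount≤2 e = ≤-trans (m≤n+m∸n c 1) (s≤s (begin
      c ∸ 1                                          ≤⟨ m≤n*m (c ∸ 1) (incidence Γ x e) {{>-nonZero 1≤inc}} ⟩
      incidence Γ x e * (c ∸ 1)                      ≤⟨ f≤sumF (λ e → incidence Γ x e * (coverCount Γ N e ∸ 1)) e ⟩
      excess x                                       ≡⟨ excess-off x (proj₂ (end-off e)) ⟩
      1                                              ∎))
      where
      open ≤-Reasoning
      c : ℕ
      c = coverCount Γ N e
      x : Fin (n Γ)
      x = end Γ e (proj₁ (end-off e))
      1≤inc : 1 ≤ incidence Γ x e
      1≤inc = HasEnd⇒1≤incidence Γ (proj₁ (end-off e) , refl)

    doubly : Fin (m Γ) → Bool
    doubly e = coverCount Γ N e ≡ᵇ 2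

    degIn-doubly≡excess : ∀ w → degIn Γ doubly w ≡ excess w
    degIn-doubly≡excess w = sumF-cong λ e →
      if-≡ᵇ2 (covered⇒1≤coverCount Γ N (covers e)) (coverCount≤2 e) (incidence Γ w e)

  pmCover⊎doublyCoveredAt : HasPMCover Γ 4 ⊎ (∀ e → HasEnd Γ e u → coverCount Γ N e ≡ 2)
  pmCover⊎doublyCoveredAt
    with perfectOff⇒degIn≡1⊎3 Γ cubic {u} {doubly} (λ x x≢u → trans (degIn-doubly≡excess x) (excess-off x x≢u))
  ... | inj₁ one   = inj₁ (N , perfect , covers)
    where
    Σdeg≡4 : sumF (λ j → degIn Γ (N j) u) ≡ 4
    Σdeg≡4 = trans (double-counting-excess u) (cong (3 +_) (trans (sym (degIn-doubly≡excess u)) one))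
    perfect : ∀ j → IsPerfectMatching Γ (N j)
    perfect j x with x ≟ u
    ... | yes refl = sym (sumF-mono-≤-≡ (λ j → 1⊎3⇒1≤ (perfectOff⇒degIn≡1⊎3 Γ cubic (perfectOff j))) (sym Σdeg≡4) j)
    ... | no  x≢u  = perfectOff j x x≢u
  ... | inj₂ three = inj₂ λ e end → ≡ᵇ⇒≡ _ 2 (degIn≡degree⇒∈ Γ doubly (trans three (sym (cubic u))) end)

≢⇒False : ∀ {k} {x y : Fin k} → x ≢ y → T (not (does (x ≟ y)))
≢⇒False {x = x} {y} x≢y with x ≟ y
... | yes x≡y = x≢y x≡y
... | no  _   = _

Avoids : (Γ : Graph) → Fin (m Γ) → Fin (n Γ) → Set
Avoids Γ e w = T (not (incidentᵇ Γ e w))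

incident? : (Γ : Graph) (e : Fin (m Γ)) (w : Fin (n Γ)) → HasEnd Γ e w ⊎ Avoids Γ e w
incident? Γ e w with end Γ e true ≟ w | end Γ e false ≟ w
... | yes p | _     = inj₁ (true , p)
... | no _  | yes q = inj₁ (false , q)
... | no _  | no _  = inj₂ _

Avoids⇒¬HasEnd : (Γ : Graph) {e : Fin (m Γ)} {w : Fin (n Γ)} → Avoids Γ e w → ¬ HasEnd Γ e w
Avoids⇒¬HasEnd Γ {e} {w} avoids (s , p) with end Γ e true ≟ w | end Γ e false ≟ w | s
... | yes _ | _     | _     = avoids
... | no _  | yes _ | _     = avoids
... | no ¬p | no _  | true  = ¬p p
... | no _  | no ¬q | false = ¬q p

otherEnd≡ : (Γ : Graph) {e : Fin (m Γ)} {x w : Fin (n Γ)} (s s′ : Bool) → end Γ e s ≡ x → end Γ e s′ ≡ w → x ≢ w →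
            end Γ e (not s′) ≡ x
otherEnd≡ Γ true  true  p q x≢w = ⊥-elim (x≢w (trans (sym p) q))
otherEnd≡ Γ true  false p q _   = p
otherEnd≡ Γ false true  p q _   = p
otherEnd≡ Γ false false p q x≢w = ⊥-elim (x≢w (trans (sym p) q))

dart-edge-injective : (Γ : Graph) → Loopless Γ → ∀ {w} (d : EndsAt Γ w) {i j} →
  proj₁ (EndsAt.dart d i) ≡ proj₁ (EndsAt.dart d j) → i ≡ j
dart-edge-injective Γ loopless d {i} {j} same =
  EndsAt.inj d i j (same-edge (EndsAt.dart d i) (EndsAt.dart d j) (EndsAt.atU d i) (EndsAt.atU d j) same)
  where
  same-edge : ∀ p q → end Γ (proj₁ p) (proj₂ p) ≡ _ → end Γ (proj₁ q) (proj₂ q) ≡ _ → proj₁ p ≡ proj₁ q → p ≡ q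
  same-edge (e , true)  (.e , true)  _ _ refl = refl
  same-edge (e , false) (.e , false) _ _ refl = refl
  same-edge (e , true)  (.e , false) p q refl = ⊥-elim (otherEnd≢ Γ loopless true p q)
  same-edge (e , false) (.e , true)  p q refl = ⊥-elim (otherEnd≢ Γ loopless false p q)

sameEnds-hit : {V : Set} {f g : Bool → V} → SameEnds f g → ∀ {y} t → f t ≡ y → ∃ λ s → g s ≡ y
sameEnds-hit (inj₁ f≗g)     t p = t , trans (sym (f≗g t)) p
sameEnds-hit (inj₂ f≗g∘not) t p = not t , trans (sym (f≗g∘not t)) p

sameEnds-sym : {V : Set} {f g : Bool → V} → SameEnds f g → SameEnds g f
sameEnds-sym (inj₁ f≗g) = inj₁ (sym ∘ f≗g)
sameEnds-sym {g = g} (inj₂ f≗g∘not) = inj₂ λ s → trans (cong g (sym (not-involutive s))) (sym (f≗g∘not (not s)))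

sameEnds-flip : {V : Set} {f g g′ : Bool → V} → SameEnds f g → (∀ s → g′ s ≡ g (not s)) → SameEnds f g′
sameEnds-flip {g = g} {g′} (inj₁ f≗g) g′≗g∘not =
  inj₂ λ s → trans (f≗g s) (trans (cong g (sym (not-involutive s))) (sym (g′≗g∘not (not s))))
sameEnds-flip (inj₂ f≗g∘not) g′≗g∘not = inj₁ λ s → trans (f≗g∘not s) (sym (g′≗g∘not s))

bijection-reindex : {A B C : Set} {f : B → C} {f′ : A → C} (g : A → B) (h : B → A) →
  (∀ b → g (h b) ≡ b) → (∀ a → h (g a) ≡ a) → (∀ a → f′ a ≡ f (g a)) → Bijection f → Bijection f′
bijection-reindex {f = f} g h g∘h≗id h∘g≗id f′≗f∘g (injective , surjective) =
  (λ a b f′a≡f′b → trans (sym (h∘g≗id a))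
     (trans (cong h (injective (g a) (g b) (trans (sym (f′≗f∘g a)) (trans f′a≡f′b (f′≗f∘g b))))) (h∘g≗id b))) ,
  (λ y → let x , fx≡y = surjective y in h x , trans (f′≗f∘g (h x)) (trans (cong f (g∘h≗id x)) fx≡y))

swap₁₂ : {A B C : Set} → A ⊎ (B ⊎ C) → B ⊎ (A ⊎ C)
swap₁₂ (inj₁ a)        = inj₂ (inj₁ a)
swap₁₂ (inj₂ (inj₁ b)) = inj₁ b
swap₁₂ (inj₂ (inj₂ c)) = inj₂ (inj₂ c)

swap₁₂-involutive : {A B C : Set} (x : A ⊎ (B ⊎ C)) → swap₁₂ (swap₁₂ x) ≡ x
swap₁₂-involutive (inj₁ _)        = refl
swap₁₂-involutive (inj₂ (inj₁ _)) = refl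
swap₁₂-involutive (inj₂ (inj₂ _)) = refl

IsThreeSum-sym : ∀ {G H K u v cut} → IsThreeSum G H u K v cut → IsThreeSum G K v H u cut
IsThreeSum-sym ts = record
  { αH = αK ; αK = αH ; βH = βK ; βK = βH ; dH = dK ; dK = dH
  ; vbij    = bijection-reindex swap swap swap-involutive swap-involutive
                (λ { (inj₁ _) → refl ; (inj₂ _) → refl }) vbij
  ; ebij    = bijection-reindex swap₁₂ swap₁₂ swap₁₂-involutive swap₁₂-involutive
                (λ { (inj₁ _) → refl ; (inj₂ (inj₁ _)) → refl ; (inj₂ (inj₂ _)) → refl }) ebij
  ; endsH   = endsK
  ; endsK   = endsH
  ; endsCut = λ i → sameEnds-flip (endsCut i) (λ { true → refl ; false → refl })
  }
  where open IsThreeSum ts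

module _ {G H K : Graph} {u : Fin (n H)} {v : Fin (n K)} {cut : Fin 3 → Fin (m G)}
         (loopless-H : Loopless H) (loopless-K : Loopless K) (ts : IsThreeSum G H u K v cut) where

  open IsThreeSum ts
  open EndsAt dH using (dart; atU; allAtU)

  private
    edgeAtU : Fin 3 → Fin (m H)
    edgeAtU i = proj₁ (dart i)

    αH-injective : ∀ {x y} → x ≢ u → y ≢ u → αH x ≡ αH y → x ≡ y
    αH-injective x≢u y≢u αx≡αy =
      cong proj₁ (inj₁-injective (proj₁ vbij (inj₁ (_ , ≢⇒False x≢u)) (inj₁ (_ , ≢⇒False y≢u)) αx≡αy))

    αH≢αK : ∀ {x y} → x ≢ u → y ≢ v → αH x ≢ αK y
    αH≢αK x≢u y≢v αx≡αy with proj₁ vbij (inj₁ (_ , ≢⇒False x≢u)) (inj₂ (_ , ≢⇒False y≢v)) αx≡αy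
    ... | ()

    cut-injective : ∀ {i j} → cut i ≡ cut j → i ≡ j
    cut-injective {i} {j} eq = inj₂-injective (inj₂-injective (proj₁ ebij (inj₂ (inj₂ i)) (inj₂ (inj₂ j)) eq))

    βH-injective : ∀ {e e′} → Avoids H e u → Avoids H e′ u → βH e ≡ βH e′ → e ≡ e′
    βH-injective a a′ eq = cong proj₁ (inj₁-injective (proj₁ ebij (inj₁ (_ , a)) (inj₁ (_ , a′)) eq))

    βH≢cut : ∀ {e} → Avoids H e u → ∀ i → βH e ≢ cut i
    βH≢cut a i eq with proj₁ ebij (inj₁ (_ , a)) (inj₂ (inj₂ i)) eq
    ... | ()

    toG : Fin (m H) → Fin (m G)
    toG e = [ (λ { (s , p) → cut (proj₁ (allAtU e s p)) }) , (λ _ → βH e) ]′ (incident? H e u)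

    toG-view : ∀ e → (∃ λ i → edgeAtU i ≡ e × toG e ≡ cut i) ⊎ (Σ (Avoids H e u) λ _ → toG e ≡ βH e)
    toG-view e with incident? H e u
    ... | inj₁ (s , p) = inj₁ (proj₁ (allAtU e s p) , cong proj₁ (proj₂ (allAtU e s p)) , refl)
    ... | inj₂ a       = inj₂ (a , refl)

    edgeAtU-HasEnd : ∀ i → HasEnd H (edgeAtU i) u
    edgeAtU-HasEnd i = proj₂ (dart i) , atU i

    toG-avoids : ∀ {e} → Avoids H e u → toG e ≡ βH e
    toG-avoids {e} a with toG-view e
    ... | inj₁ (i , refl , _) = ⊥-elim (Avoids⇒¬HasEnd H a (edgeAtU-HasEnd i))
    ... | inj₂ (_ , toGe≡βe)  = toGe≡βe

    toG-edgeAtU : ∀ i → toG (edgeAtU i) ≡ cut i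
    toG-edgeAtU i with toG-view (edgeAtU i)
    ... | inj₁ (j , same , toGe≡cut) = trans toGe≡cut (cong cut (dart-edge-injective H loopless-H dH same))
    ... | inj₂ (a , _)               = ⊥-elim (Avoids⇒¬HasEnd H a (edgeAtU-HasEnd i))

    toG-injective : ∀ {e e′} → toG e ≡ toG e′ → e ≡ e′
    toG-injective {e} {e′} eq with toG-view e | toG-view e′
    ... | inj₁ (i , refl , p) | inj₁ (j , refl , q) = cong edgeAtU (cut-injective (trans (sym p) (trans eq q)))
    ... | inj₂ (a , p)        | inj₂ (a′ , q)       = βH-injective a a′ (trans (sym p) (trans eq q))
    ... | inj₁ (i , _ , p)    | inj₂ (a′ , q)       = ⊥-elim (βH≢cut a′ i (trans (sym q) (trans (sym eq) p)))
    ... | inj₂ (a , p)        | inj₁ (j , _ , q)    = ⊥-elim (βH≢cut a j (trans (sym p) (trans eq q)))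

    otherEndH≢u : ∀ i → otherEnd H (dart i) ≢ u
    otherEndH≢u i = otherEnd≢ H loopless-H (proj₂ (dart i)) (atU i)

    otherEndK≢v : ∀ i → otherEnd K (EndsAt.dart dK i) ≢ v
    otherEndK≢v i = otherEnd≢ K loopless-K (proj₂ (EndsAt.dart dK i)) (EndsAt.atU dK i)

    toG-HasEnd : ∀ {x} → x ≢ u → ∀ {e} → HasEnd H e x → HasEnd G (toG e) (αH x)
    toG-HasEnd {x} x≢u {e} (s , p) with toG-view e
    ... | inj₂ (a , toGe≡βe) =
      subst (λ g → HasEnd G g (αH x)) (sym toGe≡βe) (sameEnds-hit (sameEnds-sym (endsH e a)) s (cong αH p))
    ... | inj₁ (i , refl , toGe≡cut) =
      subst (λ g → HasEnd G g (αH x)) (sym toGe≡cut)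
            (sameEnds-hit (sameEnds-sym (endsCut i)) true (cong αH (otherEnd≡ H s (proj₂ (dart i)) p (atU i) x≢u)))

    HasEnd-toG⁻¹ : ∀ {x} → x ≢ u → ∀ {g} → HasEnd G g (αH x) → ∃ λ e → toG e ≡ g × HasEnd H e x
    HasEnd-toG⁻¹ x≢u {g} (t , q) with proj₂ ebij g
    ... | inj₁ (e , a) , refl =
      let s , αend≡αx = sameEnds-hit (endsH e a) t q
      in e , toG-avoids a , s , αH-injective (λ p → Avoids⇒¬HasEnd H a (s , p)) x≢u αend≡αx
    ... | inj₂ (inj₁ (f , a)) , refl =
      let s , αend≡αx = sameEnds-hit (endsK f a) t q
      in ⊥-elim (αH≢αK x≢u (λ p → Avoids⇒¬HasEnd K a (s , p)) (sym αend≡αx))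
    ... | inj₂ (inj₂ i) , refl with sameEnds-hit (endsCut i) t q
    ...   | true  , αend≡αx = edgeAtU i , toG-edgeAtU i , not (proj₂ (dart i)) , αH-injective (otherEndH≢u i) x≢u αend≡αx
    ...   | false , αend≡αx = ⊥-elim (αH≢αK x≢u (otherEndK≢v i) (sym αend≡αx))

    perfect⇒restriction-perfectOff : ∀ {S} → IsPerfectMatching G S → IsPerfectOff H u (S ∘ toG)
    perfect⇒restriction-perfectOff {S} perfect x x≢u =
      degIn≡1-pullback H G loopless-H toG toG-injective (toG-HasEnd x≢u) (HasEnd-toG⁻¹ x≢u) S (perfect (αH x))

  cut-doublyCovered : Cubic H → PiAtLeast H 5 → ∀ {M} → IsPMCover G 4 M → ∀ i → DoublyCovered G M (cut i)
  cut-doublyCovered cubic π≥5 {M} (perfect , covers) i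
    with pmCover⊎doublyCoveredAt H cubic loopless-H {u} {λ j → M j ∘ toG}
           (λ j → perfect⇒restriction-perfectOff (perfect j)) (covers ∘ toG)
  ... | inj₁ cover  = ⊥-elim (π≥5 4 ≤-refl cover)
  ... | inj₂ doubly = subst (DoublyCovered G M) (toG-edgeAtU i) (doubly (edgeAtU i) (edgeAtU-HasEnd i))

lemma6p3 : (G H K : Graph) (u : Fin (n H)) (v : Fin (n K)) (cut : Fin 3 → Fin (m G)) →
    Cubic H → Cubic K → TwoConnected H → TwoConnected K →
    IsThreeSum G H u K v cut →
    PiEq G 4 →
    PiAtLeast H 5 ⊎ PiAtLeast K 5 →
    (M : Fin 4 → Fin (m G) → Bool) → IsPMCover G 4 M →
    ∀ i → DoublyCovered G M (cut i)
lemma6p3 G H K u v cut cubic-H cubic-K (_ , loopless-H , _) (_ , loopless-K , _) ts _ (inj₁ π[H]≥5) M cover =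
  cut-doublyCovered loopless-H loopless-K ts cubic-H π[H]≥5 cover
lemma6p3 G H K u v cut cubic-H cubic-K (_ , loopless-H , _) (_ , loopless-K , _) ts _ (inj₂ π[K]≥5) M cover =
  cut-doublyCovered loopless-K loopless-H (IsThreeSum-sym ts) cubic-K π[K]≥5 cover
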